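{- There exist constants $c>0$ and $n_0$ such that for every $n\ge n_0$ there exists a family of $n$ axis-parallel boxes in $\mathbb{R}^{3}$ whose intersection graph is bipartite, contains no copy of $K_{2,2}$, and has at least $c\,n\frac{\log n}{\log\log n}$ edges.
   Context: An axis-parallel box in $\mathbb{R}^3$ is a set $[a_1,b_1]\times[a_2,b_2]\times[a_3,b_3]$. The intersection graph of a family of sets has the sets as vertices, two adjacent if they intersect. "Contains no copy of $K_{2,2}$" means no (not necessarily induced) subgraph isomorphic to $K_{2,2}$. -}

module Defs where

open import Data.Nat using (ℕ; zero; suc; _+_; _*_; _≤_; _<_)
open import Data.Nat.Logarithm using (⌊log₂_⌋)
open import Data.Integer using (ℤ) renaming (_≤_ to _≤ℤ_; _≤?_ to _≤ℤ?_)
open import Data.Fin using (Fin; toℕ)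
open import Data.Fin.Properties using (all?) renaming (_≟_ to _≟F_)
open import Data.Bool using (Bool; true; false; if_then_else_)
open import Data.List using (List; map; allFin)
open import Data.Nat.ListAction using (sum)
open import Data.Product using (_×_; _,_; Σ; ∃)
open import Relation.Nullary using (¬_; Dec; yes; no)
open import Relation.Nullary.Decidable using (_×-dec_; ¬?; does)
open import Relation.Binary.PropositionalEquality using (_≡_)

record Box : Set where
  field
    lo    : Fin 3 → ℤ
    hi    : Fin 3 → ℤ
    valid : ∀ i → lo i ≤ℤ hi i
open Box public

Intersect : Box → Box → Set
Intersect B C = ∀ i → (lo B i ≤ℤ hi C i) × (lo C i ≤ℤ hi B i)

intersect? : (B C : Box) → Dec (Intersect B C)
intersect? B C = all? (λ i → (lo B i ≤ℤ? hi C i) ×-dec (lo C i ≤ℤ? hi B i))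

Adj : ∀ {n} → (Fin n → Box) → Fin n → Fin n → Set
Adj F i j = (¬ i ≡ j) × Intersect (F i) (F j)

adj? : ∀ {n} (F : Fin n → Box) (i j : Fin n) → Dec (Adj F i j)
adj? F i j = ¬? (i ≟F j) ×-dec intersect? (F i) (F j)

Bipartite : ∀ {n} → (Fin n → Box) → Set
Bipartite {n} F = Σ (Fin n → Bool) λ col → ∀ i j → Adj F i j → ¬ col i ≡ col j

K22Free : ∀ {n} → (Fin n → Box) → Set
K22Free {n} F = (a₁ a₂ b₁ b₂ : Fin n) → ¬ a₁ ≡ a₂ → ¬ b₁ ≡ b₂ →
  ¬ (Adj F a₁ b₁ × Adj F a₁ b₂ × Adj F a₂ b₁ × Adj F a₂ b₂)

boolToℕ : Bool → ℕ
boolToℕ true  = 1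
boolToℕ false = 0

edgeCount : ∀ {n} → (Fin n → Box) → ℕ
edgeCount {n} F = sum (map (λ i → sum (map (λ j →
  boolToℕ (does (toℕ i Data.Nat.<? toℕ j) Data.Bool.∧ does (adj? F i j))) (allFin n))) (allFin n))
  where open import Data.Nat using (_<?_)
        open import Data.Bool using (_∧_)

-- Points: P = q b^t pairs (p, rev p), rev reversing the t lowest base-b digits. Rectangles: for
-- each level l < t, the grid of products of an aligned x-interval of length b^(l+1) and an aligned
-- y-interval of length b^(t-l). Every point lies in exactly one rectangle of each level, giving
-- P t incidences. Two points sharing a rectangle of level l agree in all digits from position l + 1
-- up, and two points sharing a rectangle of level l' agree in their l' lowest digits (read off the
-- reversed coordinate), so two points never share rectangles of two different levels, and inside one
-- level the rectangle of a point is unique: the incidence graph is K₂,₂-free. Raising the points to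
-- vertical segments and putting the rectangles at distinct heights turns it into an intersection
-- graph of boxes. With b = 2^k, k = log log n, t = log n / 2k and q chosen to use up the n boxes,
-- P t ≥ n log n / (16 log log n).
module Submission where

open import Data.Bool using (Bool; _∧_)
open import Data.Empty using (⊥)
open import Data.Fin using (Fin; toℕ) renaming (zero to fzero; suc to fsuc)
open import Data.Fin.Properties using (toℕ-injective) renaming (_≟_ to _≟ᶠ_)
open import Data.Integer using (+≤+) renaming (+_ to toℤ; _≤_ to _≤ℤ_)
open import Data.Integer.Properties using (drop‿+≤+)
open import Data.List using (map; allFin; tabulate)
open import Data.List.Properties using (map-tabulate)
open import Data.Nat
open import Data.Nat.DivMod
open import Data.Nat.Divisibility using (divides)
open import Data.Nat.ListAction using (sum)
open import Data.Nat.Logarithm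
open import Data.Nat.Properties
open import Algebra.Properties.CommutativeSemigroup *-commutativeSemigroup using (x∙yz≈y∙xz)
open import Data.Nat.Tactic.RingSolver using (solve-∀)
open import Data.Product using (Σ; _×_; _,_; proj₁; proj₂)
open import Data.Sum using (_⊎_; inj₁; inj₂; [_,_]′)
open import Function using (_∘_)
open import Relation.Binary.Definitions using (tri<; tri≈; tri>)
open import Relation.Binary.PropositionalEquality
open import Relation.Nullary using (¬_; Dec; yes; no; contradiction)
open import Relation.Nullary.Decidable using (does; dec-true; dec-false; ¬?; _×-dec_)
open import Defs

module _ {n : ℕ} .{{_ : NonZero n}} where

  m<m/n*n+n : ∀ m → m < m / n * n + n
  m<m/n*n+n m = begin-strict
    m                  ≡⟨ m≡m%n+[m/n]*n m n ⟩
    m % n + m / n * n  <⟨ +-monoˡ-< (m / n * n) (m%n<n m n) ⟩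
    n + m / n * n      ≡⟨ +-comm n (m / n * n) ⟩
    m / n * n + n      ∎
    where open ≤-Reasoning

  /-unique : ∀ {q m} → q * n ≤ m → m < q * n + n → m / n ≡ q
  /-unique {q} {m} lo hi = ≤-antisym (s≤s⁻¹ m/n<1+q) q≤m/n
    where
    q≤m/n : q ≤ m / n
    q≤m/n = subst (_≤ m / n) (m*n/n≡m q n) (/-monoˡ-≤ n lo)
    m/n<1+q : m / n < suc q
    m/n<1+q = m<n*o⇒m/o<n (subst (m <_) (+-comm (q * n) n) hi)

  [m*n+o]/n≡m : ∀ m {o} → o < n → (m * n + o) / n ≡ m
  [m*n+o]/n≡m m {o} o<n = /-unique (m≤m+n (m * n) o) (+-monoʳ-< (m * n) o<n)

  [m*n+o]%n≡o : ∀ m {o} → o < n → (m * n + o) % n ≡ o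
  [m*n+o]%n≡o m {o} o<n = begin
    (m * n + o) % n  ≡⟨ %-congˡ (+-comm (m * n) o) ⟩
    (o + m * n) % n  ≡⟨ [m+kn]%n≡m%n o m n ⟩
    o % n            ≡⟨ m<n⇒m%n≡m o<n ⟩
    o                ∎
    where open ≡-Reasoning

  *+-injective : ∀ {m o m′ o′} → o < n → o′ < n → m * n + o ≡ m′ * n + o′ → m ≡ m′ × o ≡ o′
  *+-injective {m} {o} {m′} {o′} o<n o′<n eq =
    trans (sym ([m*n+o]/n≡m m o<n)) (trans (/-congˡ eq) ([m*n+o]/n≡m m′ o′<n)) ,
    trans (sym ([m*n+o]%n≡o m o<n)) (trans (%-congˡ eq) ([m*n+o]%n≡o m′ o′<n))

  m<2*[m/n*n] : ∀ {m} → n ≤ m → m < 2 * (m / n * n)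
  m<2*[m/n*n] {m} n≤m = begin-strict
    m                      <⟨ m<m/n*n+n m ⟩
    m / n * n + n          ≤⟨ +-monoʳ-≤ (m / n * n) n≤m/n*n ⟩
    m / n * n + m / n * n  ≡⟨ cong (m / n * n +_) (sym (+-identityʳ _)) ⟩
    2 * (m / n * n)        ∎
    where
    open ≤-Reasoning
    n≤m/n*n : n ≤ m / n * n
    n≤m/n*n = subst (_≤ m / n * n) (*-identityˡ n) (*-monoˡ-≤ n (m≥n⇒m/n>0 n≤m))

  suc[o+pred[n]]≡o+n : ∀ o → suc (o + pred n) ≡ o + n
  suc[o+pred[n]]≡o+n o = trans (sym (+-suc o (pred n))) (cong (o +_) (suc-pred n))

  m≤o+pred[n]⇒m<o+n : ∀ {o m} → m ≤ o + pred n → m < o + n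
  m≤o+pred[n]⇒m<o+n {o} {m} m≤ = subst (m <_) (suc[o+pred[n]]≡o+n o) (s≤s m≤)

  m<o+n⇒m≤o+pred[n] : ∀ {o m} → m < o + n → m ≤ o + pred n
  m<o+n⇒m≤o+pred[n] {o} {m} m< = s≤s⁻¹ (subst (m <_) (sym (suc[o+pred[n]]≡o+n o)) m<)

  /≡⇒∈block : ∀ {q m} → m / n ≡ q → q * n ≤ m × m ≤ q * n + pred n
  /≡⇒∈block {q} {m} refl = m/n*n≤m m n , m<o+n⇒m≤o+pred[n] (m<m/n*n+n m)

  ∈block⇒/≡ : ∀ {q m} → q * n ≤ m → m ≤ q * n + pred n → m / n ≡ q
  ∈block⇒/≡ lo hi = /-unique lo (m≤o+pred[n]⇒m<o+n hi)

sumBelow : ℕ → (ℕ → ℕ) → ℕ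
sumBelow zero    h = 0
sumBelow (suc n) h = h 0 + sumBelow n (h ∘ suc)

sumBelow-+ : ∀ m n h → sumBelow (m + n) h ≡ sumBelow m h + sumBelow n (λ k → h (m + k))
sumBelow-+ zero    n h = refl
sumBelow-+ (suc m) n h = trans (cong (h 0 +_) (sumBelow-+ m n (h ∘ suc)))
                               (sym (+-assoc (h 0) _ _))

sumBelow-monoˡ-≤ : ∀ {m n} h → m ≤ n → sumBelow m h ≤ sumBelow n h
sumBelow-monoˡ-≤ {m} {n} h m≤n = begin
  sumBelow m h                                       ≤⟨ m≤m+n _ _ ⟩
  sumBelow m h + sumBelow (n ∸ m) (λ k → h (m + k)) ≡⟨ sym (sumBelow-+ m (n ∸ m) h) ⟩
  sumBelow (m + (n ∸ m)) h                           ≡⟨ cong (λ k → sumBelow k h) (m+[n∸m]≡n m≤n) ⟩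
  sumBelow n h                                       ∎
  where open ≤-Reasoning

≤sumBelow : ∀ {k n} h → k < n → h k ≤ sumBelow n h
≤sumBelow {zero}  {suc n} h _          = m≤m+n (h 0) _
≤sumBelow {suc k} {suc n} h (s≤s k<n) = ≤-trans (≤sumBelow (h ∘ suc) k<n) (m≤n+m _ (h 0))

hit-per-block⇒≤sumBelow : ∀ t Q h (o : ℕ → ℕ) →
  (∀ l → l < t → o l < Q) → (∀ l → l < t → 1 ≤ h (l * Q + o l)) → t ≤ sumBelow (t * Q) h
hit-per-block⇒≤sumBelow zero    Q h o o<Q hit = z≤n
hit-per-block⇒≤sumBelow (suc t) Q h o o<Q hit = begin
  1 + t                                               ≤⟨ +-mono-≤ first rest ⟩
  sumBelow Q h + sumBelow (t * Q) (λ k → h (Q + k))   ≡⟨ sym (sumBelow-+ Q (t * Q) h) ⟩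
  sumBelow (suc t * Q) h                              ∎
  where
  open ≤-Reasoning
  first : 1 ≤ sumBelow Q h
  first = ≤-trans (hit 0 (s≤s z≤n)) (≤sumBelow h (o<Q 0 (s≤s z≤n)))
  rest : t ≤ sumBelow (t * Q) (λ k → h (Q + k))
  rest = hit-per-block⇒≤sumBelow t Q (λ k → h (Q + k)) (o ∘ suc)
           (λ l l<t → o<Q (suc l) (s≤s l<t))
           (λ l l<t → subst (λ k → 1 ≤ h k) (+-assoc Q (l * Q) (o (suc l))) (hit (suc l) (s≤s l<t)))

sumBelow≤sum-tabulate : ∀ {n} h (g : Fin n → ℕ) → (∀ j → h (toℕ j) ≤ g j) →
  sumBelow n h ≤ sum (tabulate g)
sumBelow≤sum-tabulate {zero}  h g h≤g = z≤n
sumBelow≤sum-tabulate {suc n} h g h≤g =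
  +-mono-≤ (h≤g fzero) (sumBelow≤sum-tabulate (h ∘ suc) (g ∘ fsuc) (h≤g ∘ fsuc))

*≤sum-tabulate : ∀ {n} m c (g : Fin n → ℕ) → m ≤ n → (∀ j → toℕ j < m → c ≤ g j) →
  m * c ≤ sum (tabulate g)
*≤sum-tabulate zero    c g m≤n c≤g = z≤n
*≤sum-tabulate (suc m) c g (s≤s m≤n) c≤g =
  +-mono-≤ (c≤g fzero (s≤s z≤n)) (*≤sum-tabulate m c (g ∘ fsuc) m≤n (λ j j<m → c≤g (fsuc j) (s≤s j<m)))

sum-map-allFin : ∀ {n} (g : Fin n → ℕ) → sum (map g (allFin n)) ≡ sum (tabulate g)
sum-map-allFin g = cong sum (map-tabulate (λ i → i) g)

2^≤⇒≤⌊log₂⌋ : ∀ a {n} → 2 ^ a ≤ n → a ≤ ⌊log₂ n ⌋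
2^≤⇒≤⌊log₂⌋ a {n} le = subst (_≤ ⌊log₂ n ⌋) (⌊log₂[2^n]⌋≡n a) (⌊log₂⌋-mono-≤ le)

≤⌊log₂⌋⇒2^≤ : ∀ a {n} → 1 ≤ n → a ≤ ⌊log₂ n ⌋ → 2 ^ a ≤ n
≤⌊log₂⌋⇒2^≤ zero    1≤n _ = 1≤n
≤⌊log₂⌋⇒2^≤ (suc a) {suc (suc n)} _ a<log = begin
  2 * 2 ^ a        ≤⟨ *-monoʳ-≤ 2 (≤⌊log₂⌋⇒2^≤ a (s≤s z≤n) a≤log[m/2]) ⟩
  2 * ⌊ m /2⌋      ≡⟨ cong (⌊ m /2⌋ +_) (+-identityʳ _) ⟩
  ⌊ m /2⌋ + ⌊ m /2⌋ ≤⟨ +-monoʳ-≤ ⌊ m /2⌋ (⌊n/2⌋≤⌈n/2⌉ m) ⟩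
  ⌊ m /2⌋ + ⌈ m /2⌉ ≡⟨ ⌊n/2⌋+⌈n/2⌉≡n m ⟩
  m                ∎
  where
  open ≤-Reasoning
  m = suc (suc n)
  a≤log[m/2] : a ≤ ⌊log₂ ⌊ m /2⌋ ⌋
  a≤log[m/2] = subst (a ≤_) (sym (⌊log₂⌊n/2⌋⌋≡⌊log₂n⌋∸1 m)) (∸-monoˡ-≤ 1 a<log)

n<2^suc⌊log₂n⌋ : ∀ n → n < 2 ^ suc ⌊log₂ n ⌋
n<2^suc⌊log₂n⌋ n = ≰⇒> (λ 2^≤n → <-irrefl refl (2^≤⇒≤⌊log₂⌋ (suc ⌊log₂ n ⌋) 2^≤n))

4*n≤2^n : ∀ n → 4 ≤ n → 4 * n ≤ 2 ^ n
4*n≤2^n (suc n) (s≤s 3≤n) with m≤n⇒m<n∨m≡n 3≤n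
... | inj₂ refl = ≤-refl
... | inj₁ 4≤n = begin
  4 * suc n          ≡⟨ *-suc 4 n ⟩
  4 + 4 * n          ≤⟨ +-mono-≤ (≤-trans 4≤n (≤-trans (m≤n*m n 4) (4*n≤2^n n 4≤n))) (4*n≤2^n n 4≤n) ⟩
  2 ^ n + 2 ^ n      ≡⟨ cong (2 ^ n +_) (sym (+-identityʳ _)) ⟩
  2 ^ suc n          ∎
  where open ≤-Reasoning

module Reversal (b : ℕ) .{{_ : NonZero b}} where

  b^≢0 : ∀ k → NonZero (b ^ k)
  b^≢0 k = m^n≢0 b k

  infixl 7 _/b^_ _%b^_
  _/b^_ _%b^_ : ℕ → ℕ → ℕ
  x /b^ k = (x / b ^ k) {{b^≢0 k}}
  x %b^ k = (x % b ^ k) {{b^≢0 k}}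

  rev : ℕ → ℕ → ℕ
  rev zero    p = 0
  rev (suc k) p = p % b * b ^ k + rev k (p / b)

  rev< : ∀ k p → rev k p < b ^ k
  rev< zero    p = s≤s z≤n
  rev< (suc k) p = begin-strict
    p % b * b ^ k + rev k (p / b)  <⟨ +-monoʳ-< (p % b * b ^ k) (rev< k (p / b)) ⟩
    p % b * b ^ k + b ^ k          ≡⟨ +-comm (p % b * b ^ k) (b ^ k) ⟩
    suc (p % b) * b ^ k            ≤⟨ *-monoˡ-≤ (b ^ k) (m%n<n p b) ⟩
    b * b ^ k                      ∎
    where open ≤-Reasoning

  c*b^[m+n]≡c*b^m*b^n : ∀ c m n → c * b ^ (m + n) ≡ c * b ^ m * b ^ n
  c*b^[m+n]≡c*b^m*b^n c m n = trans (cong (c *_) (^-distribˡ-+-* b m n)) (sym (*-assoc c (b ^ m) (b ^ n)))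

  [c*b^[m+s]+r]/b^s≡c*b^m+r/b^s : ∀ c m s r → (c * b ^ (m + s) + r) /b^ s ≡ c * b ^ m + r /b^ s
  [c*b^[m+s]+r]/b^s≡c*b^m+r/b^s c m s r = begin
    (c * b ^ (m + s) + r) /b^ s        ≡⟨ /-congˡ {o = b ^ s} (cong (_+ r) (c*b^[m+n]≡c*b^m*b^n c m s)) ⟩
    (c * b ^ m * b ^ s + r) /b^ s      ≡⟨ +-distrib-/-∣ˡ r {b ^ s} (divides (c * b ^ m) refl) ⟩
    c * b ^ m * b ^ s /b^ s + r /b^ s  ≡⟨ cong (_+ r /b^ s) (m*n/n≡m (c * b ^ m) (b ^ s)) ⟩
    c * b ^ m + r /b^ s                ∎
    where
    open ≡-Reasoning
    instance _ = b^≢0 s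

  <b^[m+s]⇒/b^s<b^m : ∀ m s {r} → r < b ^ (m + s) → r /b^ s < b ^ m
  <b^[m+s]⇒/b^s<b^m m s {r} r< = m<n*o⇒m/o<n (subst (r <_) (^-distribˡ-+-* b m s) r<)
    where instance _ = b^≢0 s

  /b^suc≡/b/b^ : ∀ p l → p /b^ suc l ≡ p / b /b^ l
  /b^suc≡/b/b^ p l = sym (m/n/o≡m/[n*o] p b (b ^ l) {{_}} {{b^≢0 l}} {{b^≢0 (suc l)}})

  -- rev (m + s) p /b^ s is the reversal of the m lowest digits of p
  high∧reversed-low-digits⇒≡ : ∀ l m s {p₁ p₂} → l ≤ m → p₁ /b^ l ≡ p₂ /b^ l →
    rev (m + s) p₁ /b^ s ≡ rev (m + s) p₂ /b^ s → p₁ ≡ p₂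
  high∧reversed-low-digits⇒≡ zero m s {p₁} {p₂} _ high _ =
    trans (sym (n/1≡n p₁)) (trans high (n/1≡n p₂))
  high∧reversed-low-digits⇒≡ (suc l) (suc m) s {p₁} {p₂} (s≤s l≤m) high low = begin
    p₁                   ≡⟨ m≡m%n+[m/n]*n p₁ b ⟩
    p₁ % b + p₁ / b * b  ≡⟨ cong₂ (λ x y → x + y * b) (proj₁ digits) rest ⟩
    p₂ % b + p₂ / b * b  ≡⟨ sym (m≡m%n+[m/n]*n p₂ b) ⟩
    p₂                   ∎
    where
    open ≡-Reasoning
    split : ∀ p → rev (suc m + s) p /b^ s ≡ p % b * b ^ m + rev (m + s) (p / b) /b^ s
    split p = [c*b^[m+s]+r]/b^s≡c*b^m+r/b^s (p % b) m s (rev (m + s) (p / b))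
    digits : p₁ % b ≡ p₂ % b × rev (m + s) (p₁ / b) /b^ s ≡ rev (m + s) (p₂ / b) /b^ s
    digits = *+-injective {{b^≢0 m}}
               (<b^[m+s]⇒/b^s<b^m m s (rev< (m + s) (p₁ / b)))
               (<b^[m+s]⇒/b^s<b^m m s (rev< (m + s) (p₂ / b)))
               (trans (sym (split p₁)) (trans low (split p₂)))
    rest : p₁ / b ≡ p₂ / b
    rest = high∧reversed-low-digits⇒≡ l m s l≤m
             (trans (sym (/b^suc≡/b/b^ p₁ l)) (trans high (/b^suc≡/b/b^ p₂ l))) (proj₂ digits)

pattern x-axis = fzero
pattern y-axis = fsuc fzero
pattern z-axis = fsuc (fsuc fzero)

cuboid : ∀ x₀ x₁ y₀ y₁ z₀ z₁ → x₀ ≤ x₁ → y₀ ≤ y₁ → z₀ ≤ z₁ → Box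
cuboid x₀ x₁ y₀ y₁ z₀ z₁ x₀≤x₁ y₀≤y₁ z₀≤z₁ = record
  { lo    = λ { x-axis → toℤ x₀ ; y-axis → toℤ y₀ ; z-axis → toℤ z₀ }
  ; hi    = λ { x-axis → toℤ x₁ ; y-axis → toℤ y₁ ; z-axis → toℤ z₁ }
  ; valid = λ { x-axis → +≤+ x₀≤x₁ ; y-axis → +≤+ y₀≤y₁ ; z-axis → +≤+ z₀≤z₁ } }

Intersect-sym : ∀ {A C} → Intersect A C → Intersect C A
Intersect-sym I i = proj₂ (I i) , proj₁ (I i)

module Construction (b′ q′ u : ℕ) where

  b q t : ℕ
  b = suc b′
  q = suc q′
  t = suc u

  open Reversal b public

  P Q N : ℕ
  P = q * b ^ t
  Q = q * b ^ u
  N = P + t * Q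

  instance
    Q≢0 : NonZero Q
    Q≢0 = m*n≢0 q (b ^ u) {{_}} {{b^≢0 u}}

  -- Indices below P are points. An index r ∈ [P, N) is the rectangle of level l < t with
  -- r - P = l * Q + a * b ^ l + e, where e < b ^ l; its x-side is the a-th interval of length
  -- b ^ (l + 1) and its y-side the e-th interval of length b ^ (t - l).
  level offset xBlock yBlock : ℕ → ℕ
  level  r = (r ∸ P) / Q
  offset r = (r ∸ P) % Q
  xBlock r = offset r /b^ level r
  yBlock r = offset r %b^ level r

  -- Points are vertical segments spanning the heights [0, N]; every index k ≥ P sits alone at
  -- height k + 1, so only points and rectangles can meet. Indices k ≥ N are isolated padding.
  pointBox rectBox padBox slab boxAt : ℕ → Box
  pointBox p = cuboid p p (rev t p) (rev t p) 0 N ≤-refl ≤-refl z≤n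
  rectBox r = cuboid (xBlock r * X) (xBlock r * X + pred X) (yBlock r * Y) (yBlock r * Y + pred Y)
                     (suc r) (suc r) (m≤m+n _ _) (m≤m+n _ _) ≤-refl
    where
    X Y : ℕ
    X = b ^ suc (level r)
    Y = b ^ (t ∸ level r)
  padBox k = cuboid 0 0 0 0 (suc k) (suc k) z≤n z≤n ≤-refl

  slab k with k <? N
  ... | yes _ = rectBox k
  ... | no  _ = padBox k

  boxAt k with k <? P
  ... | yes _ = pointBox k
  ... | no  _ = slab k

  xBlockOf yBlockOf : ℕ → ℕ → ℕ
  xBlockOf p l = p /b^ suc l
  yBlockOf p l = rev t p /b^ (t ∸ l)

  _∈ᴿ_ : ℕ → ℕ → Set
  p ∈ᴿ r = xBlockOf p (level r) ≡ xBlock r × yBlockOf p (level r) ≡ yBlock r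

  Intersect⇒∈ᴿ : ∀ p r → Intersect (pointBox p) (rectBox r) → p ∈ᴿ r
  Intersect⇒∈ᴿ p r I =
    ∈block⇒/≡ {{b^≢0 (suc (level r))}} (drop‿+≤+ (proj₂ (I x-axis))) (drop‿+≤+ (proj₁ (I x-axis))) ,
    ∈block⇒/≡ {{b^≢0 (t ∸ level r)}} (drop‿+≤+ (proj₂ (I y-axis))) (drop‿+≤+ (proj₁ (I y-axis)))

  ∈ᴿ⇒Intersect : ∀ p r → r < N → p ∈ᴿ r → Intersect (pointBox p) (rectBox r)
  ∈ᴿ⇒Intersect p r r<N (x∈ , y∈) = λ where
      x-axis → +≤+ (proj₂ x-bounds) , +≤+ (proj₁ x-bounds)
      y-axis → +≤+ (proj₂ y-bounds) , +≤+ (proj₁ y-bounds)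
      z-axis → +≤+ z≤n , +≤+ r<N
    where
    X Y : ℕ
    X = b ^ suc (level r)
    Y = b ^ (t ∸ level r)
    x-bounds : xBlock r * X ≤ p × p ≤ xBlock r * X + pred X
    x-bounds = /≡⇒∈block {{b^≢0 (suc (level r))}} x∈
    y-bounds : yBlock r * Y ≤ rev t p × rev t p ≤ yBlock r * Y + pred Y
    y-bounds = /≡⇒∈block {{b^≢0 (t ∸ level r)}} y∈

  t*Q≤P : t ≤ b → t * Q ≤ P
  t*Q≤P t≤b = begin
    t * (q * b ^ u)  ≤⟨ *-monoˡ-≤ (q * b ^ u) t≤b ⟩
    b * (q * b ^ u)  ≡⟨ x∙yz≈y∙xz b q (b ^ u) ⟩
    q * (b * b ^ u)  ∎
    where open ≤-Reasoning

  level<t : ∀ {r} → P ≤ r → r < N → level r < t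
  level<t {r} P≤r r<N = m<n*o⇒m/o<n (subst (r ∸ P <_) (m+n∸m≡n P (t * Q)) (∸-monoˡ-< r<N P≤r))

  rect-decode : ∀ {r} → P ≤ r → r ≡ P + (level r * Q + (xBlock r * b ^ level r + yBlock r))
  rect-decode {r} P≤r = begin
    r                                        ≡⟨ sym (m+[n∸m]≡n P≤r) ⟩
    P + (r ∸ P)                              ≡⟨ cong (P +_) (div-mod (r ∸ P) Q) ⟩
    P + (level r * Q + offset r)             ≡⟨ cong (λ o → P + (level r * Q + o))
                                                   (div-mod (offset r) (b ^ level r) {{b^≢0 (level r)}}) ⟩
    P + (level r * Q + (xBlock r * b ^ level r + yBlock r)) ∎
    where
    open ≡-Reasoning
    div-mod : ∀ m n .{{_ : NonZero n}} → m ≡ m / n * n + m % n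
    div-mod m n = trans (m≡m%n+[m/n]*n m n) (+-comm (m % n) _)

  offsetOf rectOf : ℕ → ℕ → ℕ
  offsetOf p l = xBlockOf p l * b ^ l + yBlockOf p l
  rectOf p l = P + (l * Q + offsetOf p l)

  ∈ᴿ⇒≡rectOf : ∀ {p r} → P ≤ r → p ∈ᴿ r → r ≡ rectOf p (level r)
  ∈ᴿ⇒≡rectOf {p} {r} P≤r (x≡ , y≡) = trans (rect-decode P≤r)
    (cong₂ (λ a e → P + (level r * Q + (a * b ^ level r + e))) (sym x≡) (sym y≡))

  module _ {p l} (p<P : p < P) (l<t : l < t) where

    private
      l≤u : l ≤ u
      l≤u = s≤s⁻¹ l<t

    yBlockOf< : yBlockOf p l < b ^ l
    yBlockOf< = <b^[m+s]⇒/b^s<b^m l (t ∸ l)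
                  (subst (λ s → rev t p < b ^ s) (sym (m+[n∸m]≡n (<⇒≤ l<t))) (rev< t p))

    xBlockOf< : xBlockOf p l < q * b ^ (u ∸ l)
    xBlockOf< = m<n*o⇒m/o<n {{b^≢0 (suc l)}} (subst (p <_) P≡ p<P)
      where
      P≡ : P ≡ q * b ^ (u ∸ l) * b ^ suc l
      P≡ = trans (cong (λ s → q * b ^ s) (sym (trans (+-suc (u ∸ l) l) (cong suc (m∸n+n≡m l≤u)))))
                 (c*b^[m+n]≡c*b^m*b^n q (u ∸ l) (suc l))

    offsetOf< : offsetOf p l < Q
    offsetOf< = begin-strict
      xBlockOf p l * b ^ l + yBlockOf p l  <⟨ +-monoʳ-< (xBlockOf p l * b ^ l) yBlockOf< ⟩
      xBlockOf p l * b ^ l + b ^ l         ≡⟨ +-comm (xBlockOf p l * b ^ l) (b ^ l) ⟩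
      suc (xBlockOf p l) * b ^ l           ≤⟨ *-monoˡ-≤ (b ^ l) xBlockOf< ⟩
      q * b ^ (u ∸ l) * b ^ l              ≡⟨ sym (c*b^[m+n]≡c*b^m*b^n q (u ∸ l) l) ⟩
      q * b ^ (u ∸ l + l)                  ≡⟨ cong (λ s → q * b ^ s) (m∸n+n≡m l≤u) ⟩
      Q                                    ∎
      where open ≤-Reasoning

    level-rectOf : level (rectOf p l) ≡ l
    level-rectOf = trans (/-congˡ {o = Q} (m+n∸m≡n P _)) ([m*n+o]/n≡m l offsetOf<)

    offset-rectOf : offset (rectOf p l) ≡ offsetOf p l
    offset-rectOf = trans (%-congˡ {o = Q} (m+n∸m≡n P _)) ([m*n+o]%n≡o l offsetOf<)

    ∈ᴿ-rectOf : p ∈ᴿ rectOf p l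
    ∈ᴿ-rectOf rewrite level-rectOf | offset-rectOf =
      sym ([m*n+o]/n≡m {{b^≢0 l}} (xBlockOf p l) yBlockOf<) ,
      sym ([m*n+o]%n≡o {{b^≢0 l}} (xBlockOf p l) yBlockOf<)

    P≤rectOf : P ≤ rectOf p l
    P≤rectOf = m≤m+n P _

    rectOf<N : rectOf p l < N
    rectOf<N = +-monoʳ-< P (begin-strict
      l * Q + offsetOf p l  <⟨ +-monoʳ-< (l * Q) offsetOf< ⟩
      l * Q + Q             ≡⟨ +-comm (l * Q) Q ⟩
      suc l * Q             ≤⟨ *-monoˡ-≤ Q l<t ⟩
      t * Q                 ∎)
      where open ≤-Reasoning

  ∈ᴿ-levels⇒≡ : ∀ {p₁ p₂ r₁ r₂} → level r₁ < level r₂ → level r₂ < t →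
    p₁ ∈ᴿ r₁ → p₂ ∈ᴿ r₁ → p₁ ∈ᴿ r₂ → p₂ ∈ᴿ r₂ → p₁ ≡ p₂
  ∈ᴿ-levels⇒≡ {p₁} {p₂} {r₁} {r₂} l₁<l₂ l₂<t (x₁₁ , _) (x₂₁ , _) (_ , y₁₂) (_ , y₂₂) =
    high∧reversed-low-digits⇒≡ (suc (level r₁)) (level r₂) (t ∸ level r₂) l₁<l₂
      (trans x₁₁ (sym x₂₁))
      (subst (λ m → rev m p₁ /b^ (t ∸ level r₂) ≡ rev m p₂ /b^ (t ∸ level r₂))
             (sym (m+[n∸m]≡n (<⇒≤ l₂<t))) (trans y₁₂ (sym y₂₂)))

  Incident : ℕ → ℕ → Set
  Incident p r = p < P × P ≤ r × r < N × p ∈ᴿ r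

  no-K22-incidence : ∀ {p₁ p₂ r₁ r₂} → p₁ ≢ p₂ → r₁ ≢ r₂ →
    Incident p₁ r₁ → Incident p₁ r₂ → Incident p₂ r₁ → Incident p₂ r₂ → ⊥
  no-K22-incidence {p₁} {p₂} {r₁} {r₂} p₁≢p₂ r₁≢r₂
    (p₁<P , P≤r₁ , r₁<N , i₁₁) (_ , P≤r₂ , r₂<N , i₁₂) (_ , _ , _ , i₂₁) (_ , _ , _ , i₂₂)
    with <-cmp (level r₁) (level r₂)
  ... | tri≈ _ l₁≡l₂ _ = r₁≢r₂ (begin
    r₁                  ≡⟨ ∈ᴿ⇒≡rectOf P≤r₁ i₁₁ ⟩
    rectOf p₁ (level r₁) ≡⟨ cong (rectOf p₁) l₁≡l₂ ⟩
    rectOf p₁ (level r₂) ≡⟨ sym (∈ᴿ⇒≡rectOf P≤r₂ i₁₂) ⟩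
    r₂                  ∎)
    where open ≡-Reasoning
  ... | tri< l₁<l₂ _ _ = p₁≢p₂ (∈ᴿ-levels⇒≡ l₁<l₂ (level<t P≤r₂ r₂<N) i₁₁ i₂₁ i₁₂ i₂₂)
  ... | tri> _ _ l₂<l₁ = p₁≢p₂ (∈ᴿ-levels⇒≡ l₂<l₁ (level<t P≤r₁ r₁<N) i₁₂ i₂₂ i₁₁ i₂₁)

  points-disjoint : ∀ {p p′} → Intersect (pointBox p) (pointBox p′) → p ≡ p′
  points-disjoint I = ≤-antisym (drop‿+≤+ (proj₁ (I x-axis))) (drop‿+≤+ (proj₂ (I x-axis)))

  slab-height : ∀ k → lo (slab k) z-axis ≡ toℤ (suc k) × hi (slab k) z-axis ≡ toℤ (suc k)
  slab-height k with k <? N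
  ... | yes _ = refl , refl
  ... | no  _ = refl , refl

  slabs-disjoint : ∀ {k k′} → Intersect (slab k) (slab k′) → k ≡ k′
  slabs-disjoint {k} {k′} I with slab-height k | slab-height k′
  ... | lo≡ , hi≡ | lo′≡ , hi′≡ = suc-injective (≤-antisym
    (drop‿+≤+ (subst₂ _≤ℤ_ lo≡ hi′≡ (proj₁ (I z-axis))))
    (drop‿+≤+ (subst₂ _≤ℤ_ lo′≡ hi≡ (proj₂ (I z-axis)))))

  point∩slab⇒Incident : ∀ {p k} → p < P → ¬ k < P → Intersect (pointBox p) (slab k) → Incident p k
  point∩slab⇒Incident {p} {k} p<P k≮P I with k <? N
  ... | yes k<N = p<P , ≮⇒≥ k≮P , k<N , Intersect⇒∈ᴿ p k I
  ... | no  k≮N = contradiction (drop‿+≤+ (proj₂ (I z-axis))) k≮N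

  Intersect⇒Incident : ∀ {k k′} → k ≢ k′ → Intersect (boxAt k) (boxAt k′) →
    Incident k k′ ⊎ Incident k′ k
  Intersect⇒Incident {k} {k′} k≢k′ I with k <? P | k′ <? P
  ... | yes _   | yes _   = contradiction (points-disjoint I) k≢k′
  ... | yes k<P | no k′≮P = inj₁ (point∩slab⇒Incident k<P k′≮P I)
  ... | no k≮P  | yes k′<P =
    inj₂ (point∩slab⇒Incident k′<P k≮P (Intersect-sym {slab k} {pointBox k′} I))
  ... | no _    | no _    = contradiction (slabs-disjoint I) k≢k′

  Incident⇒Intersect : ∀ {p r} → Incident p r → Intersect (boxAt p) (boxAt r)
  Incident⇒Intersect {p} {r} (p<P , P≤r , r<N , p∈r) with p <? P | r <? P
  ... | no p≮P | _       = contradiction p<P p≮P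
  ... | yes _  | yes r<P = contradiction P≤r (<⇒≱ r<P)
  ... | yes _  | no _ with r <? N
  ...   | yes _   = ∈ᴿ⇒Intersect p r r<N p∈r
  ...   | no r≮N = contradiction r<N r≮N

module Family (b′ q′ u n : ℕ) where

  open Construction b′ q′ u public

  F : Fin n → Box
  F i = boxAt (toℕ i)

  Adj-sym : ∀ {i j} → Adj F i j → Adj F j i
  Adj-sym {i} {j} (i≢j , I) = i≢j ∘ sym , Intersect-sym {F i} {F j} I

  Adj⇒Incident : ∀ {i j} → Adj F i j → Incident (toℕ i) (toℕ j) ⊎ Incident (toℕ j) (toℕ i)
  Adj⇒Incident (i≢j , I) = Intersect⇒Incident (i≢j ∘ toℕ-injective) I

  Adj⇒Incident-of-point : ∀ {i j} → toℕ i < P → Adj F i j → Incident (toℕ i) (toℕ j)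
  Adj⇒Incident-of-point i<P A with Adj⇒Incident A
  ... | inj₁ inc             = inc
  ... | inj₂ (_ , P≤i , _) = contradiction P≤i (<⇒≱ i<P)

  Adj⇒Incident-of-rect : ∀ {i j} → ¬ toℕ i < P → Adj F i j → Incident (toℕ j) (toℕ i)
  Adj⇒Incident-of-rect i≮P A with Adj⇒Incident A
  ... | inj₁ (i<P , _) = contradiction i<P i≮P
  ... | inj₂ inc       = inc

  isPoint : Fin n → Bool
  isPoint i = does (toℕ i <? P)

  Incident⇒isPoint-≢ : ∀ {i j} → Incident (toℕ i) (toℕ j) → isPoint i ≢ isPoint j
  Incident⇒isPoint-≢ {i} {j} (i<P , P≤j , _)
    rewrite dec-true (toℕ i <? P) i<P | dec-false (toℕ j <? P) (≤⇒≯ P≤j) = λ ()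

  bipartite : Bipartite F
  bipartite = isPoint , λ i j A →
    [ Incident⇒isPoint-≢ , (_∘ sym) ∘ Incident⇒isPoint-≢ ]′ (Adj⇒Incident A)

  k22Free : K22Free F
  k22Free a₁ a₂ b₁ b₂ a₁≢a₂ b₁≢b₂ (A₁₁ , A₁₂ , A₂₁ , A₂₂) with Adj⇒Incident A₁₁
  ... | inj₁ I₁₁ = no-K22-incidence (a₁≢a₂ ∘ toℕ-injective) (b₁≢b₂ ∘ toℕ-injective) I₁₁ I₁₂ I₂₁ I₂₂
    where
    I₁₂ : Incident (toℕ a₁) (toℕ b₂)
    I₁₂ = Adj⇒Incident-of-point (proj₁ I₁₁) A₁₂
    I₂₁ : Incident (toℕ a₂) (toℕ b₁)
    I₂₁ = Adj⇒Incident-of-rect (≤⇒≯ (proj₁ (proj₂ I₁₁))) (Adj-sym A₂₁)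
    I₂₂ : Incident (toℕ a₂) (toℕ b₂)
    I₂₂ = Adj⇒Incident-of-point (proj₁ I₂₁) A₂₂
  ... | inj₂ I₁₁ = no-K22-incidence (b₁≢b₂ ∘ toℕ-injective) (a₁≢a₂ ∘ toℕ-injective) I₁₁ I₁₂ I₂₁ I₂₂
    where
    I₂₁ : Incident (toℕ b₂) (toℕ a₁)
    I₂₁ = Adj⇒Incident-of-rect (≤⇒≯ (proj₁ (proj₂ I₁₁))) A₁₂
    I₁₂ : Incident (toℕ b₁) (toℕ a₂)
    I₁₂ = Adj⇒Incident-of-point (proj₁ I₁₁) (Adj-sym A₂₁)
    I₂₂ : Incident (toℕ b₂) (toℕ a₂)
    I₂₂ = Adj⇒Incident-of-point (proj₁ I₂₁) (Adj-sym A₂₂)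

  edgeIndicator : Fin n → Fin n → ℕ
  edgeIndicator i j = boolToℕ (does (toℕ i <? toℕ j) ∧ does (adj? F i j))

  -- edgeIndicator on ℕ indices, so that blocks of consecutive indices can be summed
  meets : ℕ → ℕ → ℕ
  meets p k = boolToℕ (does (p <? k) ∧ does (intersect? (boxAt p) (boxAt k)))

  meets≤edgeIndicator : ∀ i j → meets (toℕ i) (toℕ j) ≤ edgeIndicator i j
  meets≤edgeIndicator i j = by-cases (toℕ i <? toℕ j) (i ≟ᶠ j) (intersect? (F i) (F j))
    where
    by-cases : (i<j? : Dec (toℕ i < toℕ j)) (i≡j? : Dec (i ≡ j)) (I? : Dec (Intersect (F i) (F j))) →
      boolToℕ (does i<j? ∧ does I?) ≤ boolToℕ (does i<j? ∧ does (¬? i≡j? ×-dec I?))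
    by-cases (no _)    _          _ = z≤n
    by-cases (yes i<j) (yes refl) _ = contradiction i<j (<-irrefl refl)
    by-cases (yes _)   (no _)     _ = ≤-refl

  forwardDegree : Fin n → ℕ
  forwardDegree i = sum (map (edgeIndicator i) (allFin n))

  module _ (N≤n : N ≤ n) where

    t≤forwardDegree : ∀ i → toℕ i < P → t ≤ forwardDegree i
    t≤forwardDegree i p<P = begin
      t                                         ≤⟨ hit-per-block⇒≤sumBelow t Q (λ k → meets p (P + k))
                                                     (offsetOf p) (λ _ → offsetOf< p<P) hit ⟩
      sumBelow (t * Q) (λ k → meets p (P + k))  ≤⟨ m≤n+m _ (sumBelow P (meets p)) ⟩
      sumBelow P (meets p) + sumBelow (t * Q) (λ k → meets p (P + k))
                                                ≡⟨ sym (sumBelow-+ P (t * Q) (meets p)) ⟩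
      sumBelow N (meets p)                      ≤⟨ sumBelow-monoˡ-≤ (meets p) N≤n ⟩
      sumBelow n (meets p)                      ≤⟨ sumBelow≤sum-tabulate (meets p) (edgeIndicator i)
                                                     (meets≤edgeIndicator i) ⟩
      sum (tabulate (edgeIndicator i))          ≡⟨ sym (sum-map-allFin (edgeIndicator i)) ⟩
      sum (map (edgeIndicator i) (allFin n))    ∎
      where
      open ≤-Reasoning
      p : ℕ
      p = toℕ i
      hit : ∀ l → l < t → 1 ≤ meets p (rectOf p l)
      hit l l<t = ≤-reflexive (sym (cong₂ (λ x y → boolToℕ (x ∧ y))
        (dec-true (p <? rectOf p l) (<-≤-trans p<P (P≤rectOf p<P l<t)))
        (dec-true (intersect? (boxAt p) (boxAt (rectOf p l)))
          (Incident⇒Intersect (p<P , P≤rectOf p<P l<t , rectOf<N p<P l<t , ∈ᴿ-rectOf p<P l<t)))))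

    edges : P * t ≤ edgeCount F
    edges = subst (P * t ≤_) (sym (sum-map-allFin forwardDegree))
      (*≤sum-tabulate P t forwardDegree (≤-trans (m≤m+n P (t * Q)) N≤n) t≤forwardDegree)

boxFamily : ∀ n b q t → 0 < b → 0 < q → 0 < t → t ≤ b → 2 * (q * b ^ t) ≤ n →
  Σ (Fin n → Box) λ F → Bipartite F × K22Free F × q * b ^ t * t ≤ edgeCount F
boxFamily n (suc b′) (suc q′) (suc u) _ _ _ t≤b 2P≤n = F , bipartite , k22Free , edges N≤n
  where
  open Family b′ q′ u n
  N≤n : N ≤ n
  N≤n = begin
    P + t * Q  ≤⟨ +-monoʳ-≤ P (t*Q≤P t≤b) ⟩
    P + P      ≡⟨ cong (P +_) (sym (+-identityʳ P)) ⟩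
    2 * P      ≤⟨ 2P≤n ⟩
    n          ∎
    where open ≤-Reasoning

module _ (n L k : ℕ) (2^L≤n : 2 ^ L ≤ n) (2^k≤L : 2 ^ k ≤ L) (L<2^[1+k] : L < 2 ^ suc k)
         (4≤k : 4 ≤ k) where

  private
    b : ℕ
    b = 2 ^ k

    instance
      k≢0 : NonZero k
      k≢0 = >-nonZero (≤-trans (s≤s z≤n) 4≤k)
      2k≢0 : NonZero (2 * k)
      2k≢0 = m*n≢0 2 k

    t B : ℕ
    t = L / (2 * k)
    B = b ^ t

    instance
      2B≢0 : NonZero (2 * B)
      2B≢0 = m*n≢0 2 B {{_}} {{m^n≢0 b t {{m^n≢0 2 k}}}}

    q : ℕ
    q = n / (2 * B)

    2k≤L : 2 * k ≤ L
    2k≤L = begin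
      2 * k  ≤⟨ *-monoˡ-≤ k (s≤s (s≤s (z≤n {2}))) ⟩
      4 * k  ≤⟨ 4*n≤2^n k 4≤k ⟩
      b      ≤⟨ 2^k≤L ⟩
      L      ∎
      where open ≤-Reasoning

    t*2k≤L : t * (2 * k) ≤ L
    t*2k≤L = m/n*n≤m L (2 * k)

    t≤b : t ≤ b
    t≤b = <⇒≤ (*-cancelˡ-< 2 t b (begin-strict
      2 * t        ≤⟨ *-monoʳ-≤ 2 (m≤m*n t k) ⟩
      2 * (t * k)  ≡⟨ x∙yz≈y∙xz 2 t k ⟩
      t * (2 * k)  ≤⟨ t*2k≤L ⟩
      L            <⟨ L<2^[1+k] ⟩
      2 * b        ∎))
      where open ≤-Reasoning

    0<t : 0 < t
    0<t = m≥n⇒m/n>0 2k≤L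

    L<2*t*2k : L < 2 * (t * (2 * k))
    L<2*t*2k = m<2*[m/n*n] 2k≤L

    1+kt≤L : suc (k * t) ≤ L
    1+kt≤L = begin
      1 + k * t      ≤⟨ +-monoˡ-≤ (k * t) (*-mono-≤ (≤-trans (s≤s z≤n) 4≤k) 0<t) ⟩
      k * t + k * t  ≡⟨ kt+kt≡t*2k k t ⟩
      t * (2 * k)    ≤⟨ t*2k≤L ⟩
      L              ∎
      where
      open ≤-Reasoning
      kt+kt≡t*2k : ∀ k t → k * t + k * t ≡ t * (2 * k)
      kt+kt≡t*2k = solve-∀

    2B≤n : 2 * B ≤ n
    2B≤n = begin
      2 * B            ≡⟨ cong (2 *_) (^-*-assoc 2 k t) ⟩
      2 ^ suc (k * t)  ≤⟨ ^-monoʳ-≤ 2 1+kt≤L ⟩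
      2 ^ L            ≤⟨ 2^L≤n ⟩
      n                ∎
      where open ≤-Reasoning

    0<q : 0 < q
    0<q = m≥n⇒m/n>0 2B≤n

    2qB≤n : 2 * (q * B) ≤ n
    2qB≤n = subst (_≤ n) (x∙yz≈y∙xz q 2 B) (m/n*n≤m n (2 * B))

    n<2*q*2B : n < 2 * (q * (2 * B))
    n<2*q*2B = m<2*[m/n*n] 2B≤n

  logarithmic-family : Σ (Fin n → Box) λ F → Bipartite F × K22Free F × n * L ≤ 16 * (edgeCount F * k)
  logarithmic-family with boxFamily n b q t (m^n>0 2 k) 0<q 0<t t≤b 2qB≤n
  ... | F , bip , k22 , qBt≤e = F , bip , k22 , (begin
      n * L                                    ≤⟨ *-mono-≤ (<⇒≤ n<2*q*2B) (<⇒≤ L<2*t*2k) ⟩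
      2 * (q * (2 * B)) * (2 * (t * (2 * k)))  ≡⟨ regroup q B t k ⟩
      16 * (q * B * t * k)                     ≤⟨ *-monoʳ-≤ 16 (*-monoˡ-≤ k qBt≤e) ⟩
      16 * (edgeCount F * k)                   ∎)
    where
    open ≤-Reasoning
    regroup : ∀ q B t k → 2 * (q * (2 * B)) * (2 * (t * (2 * k))) ≡ 16 * (q * B * t * k)
    regroup = solve-∀

corollary3 : Σ ℕ λ c → Σ ℕ λ n₀ → (n : ℕ) → n₀ ≤ n →
    Σ (Fin n → Box) λ F → Bipartite F × K22Free F ×
    (n * ⌊log₂ n ⌋ ≤ suc c * (edgeCount F * ⌊log₂ ⌊log₂ n ⌋ ⌋))
corollary3 = 15 , 2 ^ 16 , λ n 2^16≤n →
  let 16≤L = 2^≤⇒≤⌊log₂⌋ 16 2^16≤n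
  in  logarithmic-family n ⌊log₂ n ⌋ ⌊log₂ ⌊log₂ n ⌋ ⌋
        (≤⌊log₂⌋⇒2^≤ ⌊log₂ n ⌋ (≤-trans (s≤s z≤n) 2^16≤n) ≤-refl)
        (≤⌊log₂⌋⇒2^≤ ⌊log₂ ⌊log₂ n ⌋ ⌋ (≤-trans (s≤s z≤n) 16≤L) ≤-refl)
        (n<2^suc⌊log₂n⌋ ⌊log₂ n ⌋)
        (2^≤⇒≤⌊log₂⌋ 4 16≤L)
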